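{- Let $n\ge2$ and let $\mathcal{A}=(G,\theta)$ be the valued digraph with vertex set $\lambda_n=\{(a,b)\in[n]^2:a<b\}$, an arc from $(a,b)$ to $(c,d)$ iff $(c,d)\in\{(a,k),(k,b)\}$ for some integer $a<k<b$, and $\theta(a,b)=b-a-1$. Let $A\in IS(\mathcal{A})$ and $\sigma\in S_n$ with $A=\mathrm{Inv}(\sigma)$, and let $(a,b)\in\lambda_n\setminus A$. Then $a$ and $b$ are adjacent in $\sigma$ (i.e. $\sigma^{ -1}(b)=\sigma^{ -1}(a)+1$) if and only if $(a,b)$ is erasable in $\mathcal{A}_A$.
   Context: Valued digraph: pair $(G,\theta)$, $G=(V,E)$ simple acyclic digraph, $\theta:V\to\mathbb{N}$ with $0\le\theta(x)\le d^+(x)$. A vertex $x$ is erasable if $\theta(x)=0$ and every $z$ with $(z,x)\in E$ has $\theta(z)\ne0$. Peeling process: repeatedly choose an erasable vertex $x_i$ of the current valued digraph, delete it and its incident arcs, and decrease by $1$ the value of each $y$ with an arc $(y,x_i)$. Peeling sequences are the sequences of chosen vertices; $IS(\mathcal{G})$ consists of $\emptyset$ and the sets $\{x_1,\dots,x_k\}$ of first $k\ge1$ entries of peeling sequences. For $A\in IS(\mathcal{G})$, $\mathcal{G}_A=(G_A,\theta_A)$ is the valued digraph obtained after removing the elements of $A$ by the peeling process: $G_A$ is the subgraph induced on $V\setminus A$ and $\theta_A(y)=\theta(y)-|\{x\in A:(y,x)\in E\}|$. $\mathrm{Inv}(\sigma)=\{(a,b)\in[n]^2:a<b,\ \sigma^{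 -1}(a)>\sigma^{ -1}(b)\}$. -}

module Defs where

open import Data.Nat using (ℕ; zero; suc; _∸_)
open import Data.Fin using (Fin; toℕ; _<_; _<?_)
open import Data.Fin.Properties using (any?) renaming (_≟_ to _≟ᶠ_)
open import Data.Fin.Permutation using (Permutation′; _⟨$⟩ʳ_; _⟨$⟩ˡ_)
open import Data.Product using (_×_; _,_; ∃; ∃-syntax)
open import Data.Product.Properties using (≡-dec)
open import Data.Sum using (_⊎_)
open import Data.List using (List; []; _∷_; _++_; length; filter)
open import Data.List.Membership.Propositional using (_∈_)
open import Relation.Nullary using (¬_; Dec)
open import Relation.Nullary.Decidable using (_×-dec_; _⊎-dec_)
open import Relation.Binary using (Decidable)
open import Relation.Binary.PropositionalEquality using (_≡_; _≢_)

-- A valued digraph is given by a vertex type V, a vertex predicate inV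
-- (the vertex set), an arc relation E (decidable, so that out-degrees into
-- a finite set can be counted) and a value function θ.
-- A subset A of removed vertices is represented by a list (the peeling
-- sequence x₁,…,x_k); its set is membership in the list.

module Peeling {V : Set} (inV : V → Set) (E : V → V → Set)
               (E? : Decidable E) (θ : V → ℕ) where

  -- θ_A(y) = θ(y) − |{x ∈ A : (y,x) ∈ E}|  (A given by the peeling sequence xs,
  -- whose entries are pairwise distinct, so counting in the list = counting in the set)
  θ[_] : List V → V → ℕ
  θ[ xs ] y = θ y ∸ length (filter (E? y) xs)

  inV[_] : List V → V → Set
  inV[ xs ] v = inV v × ¬ (v ∈ xs)

  Erasable : List V → V → Set
  Erasable xs x = inV[ xs ] x × θ[ xs ] x ≡ 0
                × (∀ z → inV[ xs ] z → E z x → θ[ xs ] z ≢ 0)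

  data PeelPrefix : List V → Set where
    []   : PeelPrefix []
    _▷_  : ∀ {xs x} → PeelPrefix xs → Erasable xs x → PeelPrefix (xs ++ (x ∷ []))

-- The valued digraph 𝒜 on λ_n = {(a,b) : a < b}.
-- [n] is modelled by Fin n = {0,…,n-1} (a shift by one; all the notions
-- involved only depend on order and differences).

Vtx : ℕ → Set
Vtx n = Fin n × Fin n

inλ : ∀ {n} → Vtx n → Set
inλ (a , b) = a < b

Arc : ∀ {n} → Vtx n → Vtx n → Set
Arc {n} (a , b) cd = ∃[ k ] (a < k × k < b × (cd ≡ (a , k) ⊎ cd ≡ (k , b)))

Arc? : ∀ {n} → Decidable (Arc {n})
Arc? (a , b) cd = any? (λ k → (a <? k) ×-dec ((k <? b) ×-dec
                    (≡-dec _≟ᶠ_ _≟ᶠ_ cd (a , k) ⊎-dec ≡-dec _≟ᶠ_ _≟ᶠ_ cd (k , b))))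

θ𝒜 : ∀ {n} → Vtx n → ℕ
θ𝒜 (a , b) = toℕ b ∸ toℕ a ∸ 1

module 𝒜 (n : ℕ) = Peeling {Vtx n} inλ Arc Arc? θ𝒜

-- Permutations: σ⁻¹(x) = σ ⟨$⟩ˡ x.

Inv : ∀ {n} → Permutation′ n → Vtx n → Set
Inv σ (a , b) = a < b × (σ ⟨$⟩ˡ b) < (σ ⟨$⟩ˡ a)

Adjacent : ∀ {n} → Permutation′ n → Fin n → Fin n → Set
Adjacent σ a b = toℕ (σ ⟨$⟩ˡ b) ≡ suc (toℕ (σ ⟨$⟩ˡ a))

module Submission where

-- Let A = Inv(σ) be reachable by peeling and write pos k = σ⁻¹(k).  For a
-- vertex (a,b) ∉ A we have pos a < pos b, and each k with a < k < b falls in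
-- exactly one of three classes: (a,k) ∈ A (pos k < pos a), (k,b) ∈ A
-- (pos b < pos k), or pos a < pos k < pos b.  The removed out-neighbours of
-- (a,b) therefore correspond bijectively (via their "middle" k) to the first
-- two classes, so θ_A(a,b) counts the third class: θ_A(a,b) = 0 iff (a,b) is
-- Clear, i.e. no value strictly between a and b sits strictly between them
-- in σ.  This is proved by comparing lengths of duplicate-free lists.
-- The theorem then follows:
--  * adjacent ⇒ erasable: (a,b) is clear, and every unremoved in-neighbour
--    (a,d) or (c,b) has b resp. a strictly between its ends, so is not clear;
--  * erasable ⇒ adjacent: otherwise take k at position pos a + 1; if k > b
--    then (a,k) is a clear in-neighbour, and if k < a then the greatest such
--    left value c gives a clear in-neighbour (c,b).

open import Defs
open import Data.Nat using (ℕ; zero; suc; _+_; _∸_; _≤_; z≤n; s≤s; s≤s⁻¹) renaming (_<_ to _<ℕ_; _≟_ to _≟ℕ_)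
open import Data.Nat.Properties
open import Data.Fin using (Fin; toℕ; fromℕ<; _<_; _>_) renaming (_≟_ to _≟ᶠ_)
import Data.Fin.Properties as Fin
open import Data.Fin.Induction using (>-wellFounded)
open import Data.Fin.Permutation using (Permutation′; _⟨$⟩ʳ_; _⟨$⟩ˡ_; inverseˡ; inverseʳ)
open import Data.List using (List; []; _∷_; length; filter; map; applyUpTo)
open import Data.List.Properties using (length-map; length-applyUpTo; filter-notAll)
open import Data.List.Membership.Propositional using (_∈_; _∉_)
open import Data.List.Membership.Propositional.Properties
  using (∈-filter⁺; ∈-filter⁻; ∈-map⁺; ∈-map⁻; ∈-applyUpTo⁺; ∈-applyUpTo⁻)
open import Data.List.Relation.Unary.Any using (here; there)
import Data.List.Relation.Unary.Any as Any
open import Data.List.Relation.Unary.All using (All; []; _∷_; tabulate; lookup)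
import Data.List.Relation.Unary.All.Properties as All
open import Data.List.Relation.Unary.AllPairs using ([]; _∷_)
open import Data.List.Relation.Unary.Unique.Propositional using (Unique)
import Data.List.Relation.Unary.Unique.Propositional.Properties as Unique
open import Data.Product using (_×_; _,_; proj₁; proj₂; ∃-syntax)
open import Data.Sum using (_⊎_; inj₁; inj₂)
open import Data.Empty using (⊥; ⊥-elim)
open import Function.Bundles using (_⇔_; Equivalence; mk⇔)
open import Induction.WellFounded using (Acc; acc)
open import Relation.Nullary using (¬_; yes; no; ¬?)
open import Relation.Nullary.Decidable using (_×-dec_)
open import Relation.Unary using (Decidable)
open import Relation.Binary.Definitions using (DecidableEquality; Tri; tri<; tri≈; tri>)
open import Relation.Binary.PropositionalEquality

map-unique : ∀ {A B : Set} (f : A → B) {xs : List A}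
  → (∀ {x y} → x ∈ xs → y ∈ xs → f x ≡ f y → x ≡ y)
  → Unique xs → Unique (map f xs)
map-unique f inj [] = []
map-unique f {x ∷ xs} inj (x∉xs ∷ distinct) =
  All.map⁺ (tabulate λ y∈xs fx≡fy → lookup x∉xs y∈xs (inj (here refl) (there y∈xs) fx≡fy))
  ∷ map-unique f (λ x∈ y∈ → inj (there x∈) (there y∈)) distinct

unique-⊆-length : ∀ {A : Set} (_≟_ : DecidableEquality A) {ys zs : List A}
  → Unique ys → (∀ {y} → y ∈ ys → y ∈ zs) → length ys ≤ length zs
unique-⊆-length _≟_ {[]} _ _ = z≤n
unique-⊆-length _≟_ {y ∷ ys} {zs} (y∉ys ∷ distinct) ys⊆zs =
  ≤-trans (s≤s (unique-⊆-length _≟_ distinct ys⊆zs-y))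
          (filter-notAll y≢? zs (Any.map (λ e y≢ → y≢ e) (ys⊆zs (here refl))))
  where
  y≢? : Decidable (y ≢_)
  y≢? z = ¬? (y ≟ z)
  ys⊆zs-y : ∀ {w} → w ∈ ys → w ∈ filter y≢? zs
  ys⊆zs-y w∈ys = ∈-filter⁺ y≢? (ys⊆zs (there w∈ys)) (lookup y∉ys w∈ys)

open-interval : ℕ → ℕ → List ℕ
open-interval lo hi = applyUpTo (suc lo +_) (hi ∸ lo ∸ 1)

∸-suc : ∀ m n → m ∸ n ∸ 1 ≡ m ∸ suc n
∸-suc zero zero = refl
∸-suc (suc m) zero = refl
∸-suc zero (suc n) = refl
∸-suc (suc m) (suc n) = ∸-suc m n

∈-open-interval⁺ : ∀ {lo hi j} → lo <ℕ j → j <ℕ hi → j ∈ open-interval lo hi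
∈-open-interval⁺ {lo} {hi} {j} lo<j j<hi =
  subst (_∈ open-interval lo hi) (m+[n∸m]≡n lo<j)
    (∈-applyUpTo⁺ (suc lo +_) (subst (j ∸ suc lo <ℕ_) (sym (∸-suc hi lo)) (∸-monoˡ-< j<hi lo<j)))

∈-open-interval⁻ : ∀ {lo hi j} → j ∈ open-interval lo hi → lo <ℕ j × j <ℕ hi
∈-open-interval⁻ {lo} {hi} j∈ with ∈-applyUpTo⁻ (suc lo +_) j∈
... | i , i<len , refl = s≤s (m≤m+n lo i) , (begin-strict
  suc lo + i                  <⟨ +-monoʳ-< (suc lo) i<len′ ⟩
  suc lo + (hi ∸ suc lo)      ≡⟨ m+[n∸m]≡n lo<hi ⟩
  hi                          ∎)
  where
  open ≤-Reasoning
  i<len′ : i <ℕ hi ∸ suc lo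
  i<len′ = subst (i <ℕ_) (∸-suc hi lo) i<len
  lo<hi : lo <ℕ hi
  lo<hi = <⇒≤ (m∸n≢0⇒n<m {hi} {suc lo} λ e → n≮0 (subst (i <ℕ_) e i<len′))

open-interval-unique : ∀ lo hi → Unique (open-interval lo hi)
open-interval-unique lo hi = Unique.applyUpTo⁺₁ (suc lo +_) _ λ i<j _ → <⇒≢ (+-monoʳ-< (suc lo) i<j)

greatest-witness : ∀ {n} {P : Fin n → Set} → Decidable P → ∀ {i} → P i
  → ∃[ m ] (P m × (∀ k → m < k → ¬ P k))
greatest-witness {P = P} P? {i} = go i (>-wellFounded i)
  where
  go : ∀ i → Acc _>_ i → P i → ∃[ m ] (P m × (∀ k → m < k → ¬ P k))
  go i (acc above) Pi with Fin.any? (λ k → (toℕ i <? toℕ k) ×-dec P? k)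
  ... | yes (k , i<k , Pk) = go k (above i<k) Pk
  ... | no none = i , Pi , λ k i<k Pk → none (k , i<k , Pk)

-- The entries of a peeling sequence are pairwise distinct, since only
-- vertices still present can be erased.
peel-unique : ∀ {n xs} → 𝒜.PeelPrefix n xs → Unique xs
peel-unique 𝒜.[] = []
peel-unique (prefix 𝒜.▷ erasable) =
  Unique.++⁺ (peel-unique prefix) ([] ∷ []) λ { (x∈xs , here refl) → proj₂ (proj₁ erasable) x∈xs }

module Inversions (n : ℕ) (σ : Permutation′ n) (xs : List (Vtx n))
                  (distinct : Unique xs) (xs≡Inv : ∀ v → v ∈ xs ⇔ Inv σ v) where

  pos : Fin n → ℕ
  pos k = toℕ (σ ⟨$⟩ˡ k)

  pos-injective : ∀ {i j} → pos i ≡ pos j → i ≡ j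
  pos-injective {i} {j} e = begin
    i                      ≡⟨ sym (inverseʳ σ) ⟩
    σ ⟨$⟩ʳ (σ ⟨$⟩ˡ i)     ≡⟨ cong (σ ⟨$⟩ʳ_) (Fin.toℕ-injective e) ⟩
    σ ⟨$⟩ʳ (σ ⟨$⟩ˡ j)     ≡⟨ inverseʳ σ ⟩
    j                      ∎
    where open ≡-Reasoning

  pos-≢ : ∀ {i j} → i < j → pos i ≢ pos j
  pos-≢ i<j e = <-irrefl (cong toℕ (pos-injective e)) i<j

  removed⇒inverted : ∀ {v} → v ∈ xs → Inv σ v
  removed⇒inverted = Equivalence.to (xs≡Inv _)

  inverted⇒removed : ∀ {v} → Inv σ v → v ∈ xs
  inverted⇒removed = Equivalence.from (xs≡Inv _)

  unremoved⇒ordered : ∀ {c d} → c < d → (c , d) ∉ xs → pos c <ℕ pos d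
  unremoved⇒ordered {c} {d} c<d c,d∉xs with <-cmp (pos c) (pos d)
  ... | tri< lt _ _ = lt
  ... | tri≈ _ e _ = ⊥-elim (pos-≢ c<d e)
  ... | tri> _ _ gt = ⊥-elim (c,d∉xs (inverted⇒removed (c<d , gt)))

  PosBetween : Fin n → Fin n → Fin n → Set
  PosBetween a b k = pos a <ℕ pos k × pos k <ℕ pos b

  Clear : Fin n → Fin n → Set
  Clear a b = ∀ k → a < k → k < b → ¬ PosBetween a b k

  consecutive⇒clear : ∀ {a b} → pos b ≡ suc (pos a) → Clear a b
  consecutive⇒clear {a} {b} next k _ _ (a<k , k<b) =
    <-irrefl refl (≤-trans (s≤s a<k) (subst (pos k <ℕ_) next k<b))

  position-trichotomy : ∀ {a b k} → pos a <ℕ pos b → a < k → k < b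
    → pos k <ℕ pos a ⊎ PosBetween a b k ⊎ pos b <ℕ pos k
  position-trichotomy {a} {b} {k} a<b a<k k<b with <-cmp (pos k) (pos a) | <-cmp (pos k) (pos b)
  ... | tri< k<a _ _ | _ = inj₁ k<a
  ... | tri≈ _ e _ | _ = ⊥-elim (pos-≢ a<k (sym e))
  ... | tri> _ _ a<k′ | tri< k<b′ _ _ = inj₂ (inj₁ (a<k′ , k<b′))
  ... | tri> _ _ _ | tri≈ _ e _ = ⊥-elim (pos-≢ k<b e)
  ... | tri> _ _ _ | tri> _ _ b<k = inj₂ (inj₂ b<k)

  Removed : Fin n → Fin n → List (Vtx n)
  Removed a b = filter (Arc? (a , b)) xs

  data RemovedTarget (a b : Fin n) : Fin n → Vtx n → Set where
    left  : ∀ {k} → a < k → k < b → pos k <ℕ pos a → RemovedTarget a b k (a , k)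
    right : ∀ {k} → a < k → k < b → pos b <ℕ pos k → RemovedTarget a b k (k , b)

  removed-target : ∀ {a b x} → x ∈ Removed a b → ∃[ k ] RemovedTarget a b k x
  removed-target {a} {b} x∈ with ∈-filter⁻ (Arc? (a , b)) {xs = xs} x∈
  ... | x∈xs , (k , a<k , k<b , inj₁ refl) = k , left a<k k<b (proj₂ (removed⇒inverted x∈xs))
  ... | x∈xs , (k , a<k , k<b , inj₂ refl) = k , right a<k k<b (proj₂ (removed⇒inverted x∈xs))

  removed-target⁺ : ∀ {a b k x} → RemovedTarget a b k x → x ∈ Removed a b
  removed-target⁺ {a} {b} (left {k} a<k k<b k<a) =
    ∈-filter⁺ (Arc? (a , b)) (inverted⇒removed (a<k , k<a)) (k , a<k , k<b , inj₁ refl)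
  removed-target⁺ {a} {b} (right {k} a<k k<b b<k) =
    ∈-filter⁺ (Arc? (a , b)) (inverted⇒removed (k<b , b<k)) (k , a<k , k<b , inj₂ refl)

  target-bounds : ∀ {a b k x} → RemovedTarget a b k x → a < k × k < b
  target-bounds (left a<k k<b _) = a<k , k<b
  target-bounds (right a<k k<b _) = a<k , k<b

  target-not-between : ∀ {a b k x} → RemovedTarget a b k x → ¬ PosBetween a b k
  target-not-between (left _ _ k<a) (a<k , _) = <-asym k<a a<k
  target-not-between (right _ _ b<k) (_ , k<b) = <-asym k<b b<k

  targets-agree : ∀ {a b k x y} → pos a <ℕ pos b
    → RemovedTarget a b k x → RemovedTarget a b k y → x ≡ y
  targets-agree _ (left _ _ _) (left _ _ _) = refl
  targets-agree _ (right _ _ _) (right _ _ _) = refl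
  targets-agree a<b (left _ _ k<a) (right _ _ b<k) = ⊥-elim (<-asym k<a (<-trans a<b b<k))
  targets-agree a<b (right _ _ b<k) (left _ _ k<a) = ⊥-elim (<-asym k<a (<-trans a<b b<k))

  middle : Fin n → Vtx n → ℕ
  middle a (c , d) with c ≟ᶠ a
  ... | yes _ = toℕ d
  ... | no _ = toℕ c

  middle-target : ∀ {a b k x} → RemovedTarget a b k x → middle a x ≡ toℕ k
  middle-target {a} (left _ _ _) with a ≟ᶠ a
  ... | yes _ = refl
  ... | no a≢a = ⊥-elim (a≢a refl)
  middle-target {a} (right {k} a<k _ _) with k ≟ᶠ a
  ... | yes refl = ⊥-elim (<-irrefl refl a<k)
  ... | no _ = refl

  middle-injective : ∀ {a b} → pos a <ℕ pos b → ∀ {x y} → x ∈ Removed a b → y ∈ Removed a b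
    → middle a x ≡ middle a y → x ≡ y
  middle-injective a<b x∈ y∈ e with removed-target x∈ | removed-target y∈
  ... | k , tx | k′ , ty with Fin.toℕ-injective (trans (sym (middle-target tx)) (trans e (middle-target ty)))
  ... | refl = targets-agree a<b tx ty

  middle-∈-interval : ∀ {a b x} → x ∈ Removed a b → middle a x ∈ open-interval (toℕ a) (toℕ b)
  middle-∈-interval x∈ with removed-target x∈
  ... | k , t = subst (_∈ _) (sym (middle-target t))
                  (∈-open-interval⁺ (proj₁ (target-bounds t)) (proj₂ (target-bounds t)))

  clear⇒interval⊆middles : ∀ {a b} → pos a <ℕ pos b → Clear a b
    → ∀ {j} → j ∈ open-interval (toℕ a) (toℕ b) → j ∈ map (middle a) (Removed a b)
  clear⇒interval⊆middles {a} {b} a<b clear {j} j∈ with ∈-open-interval⁻ j∈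
  ... | a<j , j<b = subst (_∈ _) (Fin.toℕ-fromℕ< j<n) (hit (position-trichotomy a<b a<k k<b))
    where
    j<n = <-trans j<b (Fin.toℕ<n b)
    k = fromℕ< j<n
    a<k : a < k
    a<k = subst (toℕ a <ℕ_) (sym (Fin.toℕ-fromℕ< j<n)) a<j
    k<b : k < b
    k<b = subst (_<ℕ toℕ b) (sym (Fin.toℕ-fromℕ< j<n)) j<b
    via : ∀ {x} → RemovedTarget a b k x → toℕ k ∈ map (middle a) (Removed a b)
    via t = subst (_∈ _) (middle-target t) (∈-map⁺ (middle a) (removed-target⁺ t))
    hit : pos k <ℕ pos a ⊎ PosBetween a b k ⊎ pos b <ℕ pos k → toℕ k ∈ map (middle a) (Removed a b)
    hit (inj₁ k<a) = via (left a<k k<b k<a)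
    hit (inj₂ (inj₁ between)) = ⊥-elim (clear k a<k k<b between)
    hit (inj₂ (inj₂ b<k)) = via (right a<k k<b b<k)

  -- A value k between a and b in σ is not the middle of any removed target,
  -- so at least one value of the interval is missed.
  gap⇒fewer-removed : ∀ {a b k} → pos a <ℕ pos b → a < k → k < b → PosBetween a b k
    → suc (length (Removed a b)) ≤ θ𝒜 (a , b)
  gap⇒fewer-removed {a} {b} {k} a<b a<k k<b between =
    subst₂ (λ l m → suc l ≤ m) (length-map (middle a) (Removed a b)) (length-applyUpTo _ _)
      (unique-⊆-length _≟ℕ_ (k∉middles ∷ middles-unique) ⊆interval)
    where
    middles = map (middle a) (Removed a b)
    middles-unique : Unique middles
    middles-unique = map-unique (middle a) (middle-injective a<b) (Unique.filter⁺ (Arc? (a , b)) distinct)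
    k∉middles : All (toℕ k ≢_) middles
    k∉middles = All.map⁺ (tabulate λ x∈ e → case (removed-target x∈) e)
      where
      case : ∀ {x} → ∃[ k′ ] RemovedTarget a b k′ x → toℕ k ≢ middle a x
      case (k′ , t) e with Fin.toℕ-injective (trans e (middle-target t))
      ... | refl = target-not-between t between
    ⊆interval : ∀ {j} → j ∈ toℕ k ∷ middles → j ∈ open-interval (toℕ a) (toℕ b)
    ⊆interval (here refl) = ∈-open-interval⁺ a<k k<b
    ⊆interval (there j∈) with ∈-map⁻ (middle a) j∈
    ... | x , x∈ , refl = middle-∈-interval x∈

  clear⇒θ≡0 : ∀ {a b} → pos a <ℕ pos b → Clear a b → 𝒜.θ[_] n xs (a , b) ≡ 0
  clear⇒θ≡0 {a} {b} a<b clear = m≤n⇒m∸n≡0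
    (subst₂ _≤_ (length-applyUpTo _ _) (length-map (middle a) (Removed a b))
      (unique-⊆-length _≟ℕ_ (open-interval-unique _ _) (clear⇒interval⊆middles a<b clear)))

  θ≡0⇒clear : ∀ {a b} → pos a <ℕ pos b → 𝒜.θ[_] n xs (a , b) ≡ 0 → Clear a b
  θ≡0⇒clear a<b θ≡0 k a<k k<b between =
    <⇒≱ (gap⇒fewer-removed a<b a<k k<b between) (m∸n≡0⇒m≤n θ≡0)

  adjacent⇒erasable : ∀ {a b} → a < b → (a , b) ∉ xs → Adjacent σ a b → 𝒜.Erasable n xs (a , b)
  adjacent⇒erasable {a} {b} a<b a,b∉xs adjacent =
    (a<b , a,b∉xs) , clear⇒θ≡0 (unremoved⇒ordered a<b a,b∉xs) (consecutive⇒clear adjacent) , in-neighbour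
    where
    a-before-b : pos a <ℕ pos b
    a-before-b = subst (pos a <ℕ_) (sym adjacent) ≤-refl
    in-neighbour : ∀ z → 𝒜.inV[_] n xs z → Arc z (a , b) → 𝒜.θ[_] n xs z ≢ 0
    in-neighbour (a , d) (a<d , z∉xs) (b , _ , b<d , inj₁ refl) θ≡0 =
      θ≡0⇒clear a<d′ θ≡0 b a<b b<d (a-before-b , b<d′)
      where
      a<d′ = unremoved⇒ordered a<d z∉xs
      b<d′ = ≤∧≢⇒< (subst (_≤ pos d) (sym adjacent) a<d′) (pos-≢ b<d)
    in-neighbour (c , b) (c<b , z∉xs) (a , c<a , a<b , inj₂ refl) θ≡0 =
      θ≡0⇒clear c<b′ θ≡0 a c<a a<b (c<a′ , a-before-b)
      where
      c<b′ = unremoved⇒ordered c<b z∉xs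
      c<a′ = ≤∧≢⇒< (s≤s⁻¹ (subst (pos c <ℕ_) adjacent c<b′)) (pos-≢ c<a)

  greatest-left⇒clear : ∀ {a b c} → Clear a b → c < a → PosBetween a b c
    → (∀ k → c < k → ¬ (k < a × PosBetween a b k)) → Clear c b
  greatest-left⇒clear {a} {b} {c} clear c<a (a<c , c<b) greatest k c<k k<b (c<k′ , k<b′)
    with Fin.<-cmp k a
  ... | tri< k<a _ _ = greatest k c<k (k<a , <-trans a<c c<k′ , k<b′)
  ... | tri≈ _ refl _ = <-asym a<c c<k′
  ... | tri> _ _ a<k = clear k a<k k<b (<-trans a<c c<k′ , k<b′)

  erasable⇒adjacent : ∀ {a b} → a < b → 𝒜.Erasable n xs (a , b) → Adjacent σ a b
  erasable⇒adjacent {a} {b} a<b ((_ , a,b∉xs) , θ≡0 , in-neighbour) with pos b ≟ℕ suc (pos a)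
  ... | yes adjacent = adjacent
  ... | no not-adjacent = ⊥-elim (place-next (Fin.<-cmp k a) (Fin.<-cmp k b))
    where
    a<b′ = unremoved⇒ordered a<b a,b∉xs
    clear = θ≡0⇒clear a<b′ θ≡0
    next<b : suc (pos a) <ℕ pos b
    next<b = ≤∧≢⇒< a<b′ (λ e → not-adjacent (sym e))
    next<n = <-trans next<b (Fin.toℕ<n (σ ⟨$⟩ˡ b))
    k = σ ⟨$⟩ʳ fromℕ< next<n
    pos-k : pos k ≡ suc (pos a)
    pos-k = trans (cong toℕ (inverseˡ σ)) (Fin.toℕ-fromℕ< next<n)
    k-between : PosBetween a b k
    k-between = subst (pos a <ℕ_) (sym pos-k) ≤-refl , subst (_<ℕ pos b) (sym pos-k) next<b
    LeftGap : Fin n → Set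
    LeftGap c = c < a × PosBetween a b c
    LeftGap? : Decidable LeftGap
    LeftGap? c = (toℕ c <? toℕ a) ×-dec ((pos a <? pos c) ×-dec (pos c <? pos b))
    clear-in-neighbour-of : ∀ {c d} → c < d → pos c <ℕ pos d → Clear c d → Arc (c , d) (a , b) → ⊥
    clear-in-neighbour-of c<d c<d′ clear-cd arc =
      in-neighbour _ (c<d , λ e → <-asym c<d′ (proj₂ (removed⇒inverted e))) arc (clear⇒θ≡0 c<d′ clear-cd)
    place-next : Tri (k < a) (k ≡ a) (a < k) → Tri (k < b) (k ≡ b) (b < k) → ⊥
    place-next (tri< k<a _ _) _ with greatest-witness LeftGap? (k<a , k-between)
    ... | c , (c<a , c-between) , greatest =
      clear-in-neighbour-of (<-trans c<a a<b) (proj₂ c-between)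
        (greatest-left⇒clear clear c<a c-between greatest) (a , c<a , a<b , inj₂ refl)
    place-next (tri≈ _ k≡a _) _ = <-irrefl (cong pos (sym k≡a)) (proj₁ k-between)
    place-next (tri> _ _ a<k) (tri< k<b _ _) = clear k a<k k<b k-between
    place-next (tri> _ _ _) (tri≈ _ k≡b _) = <-irrefl (cong pos k≡b) (proj₂ k-between)
    place-next (tri> _ _ a<k) (tri> _ _ b<k) =
      clear-in-neighbour-of a<k (proj₁ k-between) (consecutive⇒clear pos-k) (b , a<b , b<k , inj₁ refl)

proposition5 : (n : ℕ) → 2 ≤ n → (σ : Permutation′ n)
    → (xs : List (Vtx n)) → 𝒜.PeelPrefix n xs
    → (∀ v → v ∈ xs ⇔ Inv σ v)
    → (a b : Fin n) → a < b → ¬ (a , b) ∈ xs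
    → Adjacent σ a b ⇔ 𝒜.Erasable n xs (a , b)
proposition5 n _ σ xs prefix xs≡Inv a b a<b a,b∉xs =
  mk⇔ (adjacent⇒erasable a<b a,b∉xs) (erasable⇒adjacent a<b)
  where open Inversions n σ xs (peel-unique prefix) xs≡Inv
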